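{- Let $k\ge2$, $n\ge1$, $0\le\Delta\le\frac{n}{2(k-1)}$, and let $P$ be a length-$n$ read-once branching program over alphabet $[k]$ that computes $\mathsf{ApproxCount}_{k\text{ -counter}}[n,\Delta]$, with potential $\Phi_n$ as defined in the context. Then $$\Phi_n\ \le\ \binom{n+k-1}{k}-\binom{n-2(k-1)\Delta+k-1}{k}.$$
   Context: A length-$n$ read-once branching program (ROBP) over alphabet $\Sigma$: layered multigraph with layers $V_0,\dots,V_n$, $V_0=\{v_{\mathrm{start}}\}$, each vertex of $V_i$ ($i<n$) having $|\Sigma|$ outgoing edges into $V_{i+1}$ labeled by distinct symbols, vertices of $V_n$ labeled with outputs, every vertex reachable by some input; an input $x$ follows edges labeled $x_1,x_2,\dots$ from $v_{\mathrm{start}}$, the output is the label of the final vertex, and prefix $(x_1,\dots,x_t)$ reaches the vertex of $V_t$ on the path. $\mathsf{ApproxCount}_{k\text{ -counter}}[n,\Delta]$: on input $x\in[k]^n$ output reals $(\hat S_1,\dots,\hat S_k)$ with $|\hat S_j-\#\{i:x_i=j\}|\le\Delta$ for all $j$; $P$ computes it if the output is valid on every input. For $v\in V_t$, $R(v)=[a_1,b_1]\times\cdots\times[a_{k-1},b_{k-1}]$ where $a_j,b_j$ are the minimum and maximum of $\#\{i\in[t]:x_i=j\}$ over prefixes reaching $v$; $\mathcal R_t=\{R(v):v\in V_t\}$. $T_{t,k}=\{(x_1,\dots,x_{k-1})\in\mathbb N^{k-1}:\sum x_i\le t\}$; for $x\in T_{t,k}$, $\phi_t(x)=\max\{\min\{b_1+\cdots+b_{k-1},t\}-x_1-\cdots-x_{k-1}\}$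 over $R=\prod[a_j,b_j]\in\mathcal R_t$ with $x\in R$; $\Phi_t=\sum_{x\in T_{t,k}}\phi_t(x)$. For real $y\ge k-1$, $\binom{y}{k}=y(y-1)\cdots(y-k+1)/k!$.
   Formalization: The parameter Δ and the output labels $(\hat S_1,\dots,\hat S_k)$ of the program P are rational instead of real. -}

module Defs where

open import Data.Bool using (Bool; true; false; _∧_)
import Data.Bool
open import Data.Nat as ℕ using (ℕ; zero; suc; _+_; _*_; _∸_; _⊓_; _⊔_; _≤ᵇ_; _!)
open import Data.Nat.Properties using (_!≢0)
open import Data.Fin as Fin using (Fin; toℕ)
open import Data.Fin.Properties using () renaming (_≟_ to _≟F_)
open import Data.Vec as Vec using (Vec; []; _∷_; _∷ʳ_; init; last; lookup)
open import Data.List as List using (List; []; _∷_; map; concatMap; filter; foldr; upTo; allFin)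
open import Data.Integer using (+_)
open import Data.Nat.ListAction using () renaming (sum to sumL)
open import Data.Rational as ℚ using (ℚ; _-_; _≤_; ∣_∣)
open import Relation.Binary.PropositionalEquality using (_≡_)
open import Relation.Nullary using (does)
open import Data.Product using (Σ; ∃; _×_)

-- Read-once branching programs of length n over alphabet Fin k
-- (Fin k stands for [k]; symbol j+1 of the paper is Fin element j).
-- Layer t has vertex set Fin (width t); only layers 0..n matter.
-- Each vertex of layer t has one outgoing edge per symbol (distinct labels),
-- given by the transition function `step t`; parallel edges are allowed.
-- Final vertices are labelled by real-vector outputs (here: ℚ^k).

record ROBP (k n : ℕ) : Set where
  field
    width  : ℕ → ℕ
    width0 : width 0 ≡ 1
    start  : Fin (width 0)
    step   : (t : ℕ) → Fin (width t) → Fin k → Fin (width (suc t))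
    out    : Fin (width n) → Vec ℚ k

module _ {k n : ℕ} (P : ROBP k n) where
  open ROBP P

  run : (t : ℕ) → Vec (Fin k) t → Fin (width t)
  run zero    []  = start
  run (suc t) xs  = step t (run t (init xs)) (last xs)

  AllReachable : Set
  AllReachable = (t : ℕ) → t ℕ.≤ n → (v : Fin (width t)) →
                 ∃ λ (p : Vec (Fin k) t) → run t p ≡ v

countSym : {k t : ℕ} → ℕ → Vec (Fin k) t → ℕ
countSym j xs = Vec.count (λ a → toℕ a ℕ.≟ j) xs

Computes : {k n : ℕ} → ROBP k n → ℚ → Set
Computes {k} {n} P Δ =
  (x : Vec (Fin k) n) → (j : Fin k) →
  ∣ lookup (ROBP.out P (run P n x)) j - (ℚ._/_ (+ countSym (toℕ j) x) 1) ∣ ≤ Δ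

allVecs : (k t : ℕ) → List (Vec (Fin k) t)
allVecs k zero    = [] ∷ []
allVecs k (suc t) = concatMap (λ p → map (λ a → p ∷ʳ a) (allFin k)) (allVecs k t)

-- T_{t,k}: tuples in ℕ^m (m = k-1) with coordinate sum ≤ t
tuples : (m t : ℕ) → List (Vec ℕ m)
tuples zero    t = [] ∷ []
tuples (suc m) t = concatMap (λ a → map (a ∷_) (tuples m (t ∸ a))) (upTo (suc t))

module Potential {k n : ℕ} (P : ROBP k n) where
  open ROBP P

  reaching : (t : ℕ) → Fin (width t) → List (Vec (Fin k) t)
  reaching t v = filter (λ p → run P t p ≟F v) (allVecs k t)

  -- R(v) = ∏_j [a_j, b_j], j ranging over the first k-1 symbols.
  -- min/max over a nonempty list of counts (all ≤ t), so the defaults t / 0 are harmless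
  lo : (t : ℕ) → Fin (width t) → Fin (k ∸ 1) → ℕ
  lo t v j = foldr _⊓_ t (map (countSym (toℕ j)) (reaching t v))

  hi : (t : ℕ) → Fin (width t) → Fin (k ∸ 1) → ℕ
  hi t v j = foldr _⊔_ 0 (map (countSym (toℕ j)) (reaching t v))

  inBox : (t : ℕ) → Fin (width t) → Vec ℕ (k ∸ 1) → Bool
  inBox t v x = foldr _∧_ true
    (map (λ j → (lo t v j ≤ᵇ lookup x j) ∧ (lookup x j ≤ᵇ hi t v j)) (allFin (k ∸ 1)))

  sumHi : (t : ℕ) → Fin (width t) → ℕ
  sumHi t v = sumL (map (hi t v) (allFin (k ∸ 1)))

  phi : (t : ℕ) → Vec ℕ (k ∸ 1) → ℕ
  phi t x = foldr _⊔_ 0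
    (map (λ v → (sumHi t v ⊓ t) ∸ Vec.sum x)
         (filter (λ v → Data.Bool._≟_ (inBox t v x) true) (allFin (width t))))

  Phi : ℕ → ℕ
  Phi t = sumL (map (phi t) (tuples (k ∸ 1) t))

ℕtoℚ : ℕ → ℚ
ℕtoℚ m = ℚ._/_ (+ m) 1

falling : ℚ → ℕ → ℚ
falling y zero    = ℚ.1ℚ
falling y (suc i) = falling y i ℚ.* (y - ℕtoℚ i)

binomQ : ℚ → ℕ → ℚ
binomQ y k = falling y k ℚ.* (ℚ._/_ (+ 1) (k !) {{k !≢0}})

{-# OPTIONS --safe #-}

-- Inputs reaching the same final vertex get the same output, so their counts of any symbol
-- differ by at most 2Δ; every side b_j − a_j of a final box R(v) is therefore at most
-- e = ⌊2Δ⌋, and for x ∈ R(v) we get min(Σ b_j, n) − |x| ≤ Σ (b_j − a_j) ≤ d := (k−1)e, i.e.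
-- φ_n(x) ≤ min(d, n − |x|).  Summing g(t − |x|) over T_{t,m+1} is the m-fold iterated partial
-- sum S_m g t; S_m id t = C(t+m, m+1) by Pascal's rule, and min(d, s) = s − (s ∸ d) with
-- S_m (· ∸ d) t = S_m id (t ∸ d).  So Φ_n ≤ C(n+k−1, k) − C(n−d+k−1, k), and d ≤ 2(k−1)Δ
-- together with the monotonicity of y ↦ C(y, k) on y ≥ k − 1 finishes the proof.

module Submission where

open import Defs
open import Data.Nat using (ℕ; _+_; _*_; _∸_)
open import Data.Rational using (ℚ; 0ℚ; _≤_; _-_)
open import Data.Rational using () renaming (_*_ to _*ℚ_; _+_ to _+ℚ_)

open import Data.Bool.Base using (Bool; T; true; _∧_)
import Data.Bool.Properties as Bool
open import Data.Fin.Base as Fin using (Fin; toℕ; inject₁)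
open import Data.Fin.Properties using (toℕ-inject₁) renaming (_≟_ to _≟ᶠ_)
open import Data.Integer.Base as ℤ using (+_; +≤+)
import Data.Integer.Properties as ℤ
open import Data.List.Base as List using (List; []; _∷_; map; filter; foldr; concatMap; applyUpTo; upTo; allFin)
import Data.List.Properties as List
open import Data.List.Membership.Propositional using (_∈_)
open import Data.List.Membership.Propositional.Properties using (∈-filter⁻; ∈-map⁻; ∈-allFin; foldr-selective)
import Data.List.Relation.Unary.All as All
import Data.List.Relation.Unary.All.Properties as All
open import Data.Nat.Base as ℕ using (zero; suc; _⊓_; _⊔_; _≤ᵇ_; _!)
import Data.Nat.Properties as ℕ
open import Algebra.Properties.CommutativeSemigroup ℕ.+-commutativeSemigroup
  using () renaming (interchange to +-interchange)
open import Data.Nat.Coprimality using (1-coprimeTo) renaming (sym to coprime-sym)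
open import Data.Nat.ListAction using () renaming (sum to sumL)
open import Data.Nat.ListAction.Properties using (sum-++)
open import Data.Product.Base using (∃-syntax; _×_; _,_; proj₁; proj₂)
open import Data.Rational.Base as ℚ using (mkℚ; 1ℚ; -_; ∣_∣; *≤*)
import Data.Rational.Properties as ℚ
open import Data.Rational.Solver using (module +-*-Solver)
open +-*-Solver using (solve; _:+_; _:*_; _:-_; con; _:=_)
open import Data.Sum.Base using (inj₁; inj₂)
open import Data.Vec.Base as Vec using (Vec; lookup)
import Data.Vec.Properties as Vec
open import Function.Base using (id; _∘_)
open import Function.Bundles using (Equivalence)
open import Relation.Binary.PropositionalEquality
open import Relation.Nullary.Decidable using (yes; no)
open import Relation.Nullary.Negation using (contradiction)
open import Relation.Unary using (Decidable)

ℕtoℚ≡mkℚ : ∀ a → ℕtoℚ a ≡ mkℚ (+ a) 0 (coprime-sym (1-coprimeTo a))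
ℕtoℚ≡mkℚ a = ℚ.normalize-coprime (coprime-sym (1-coprimeTo a))

ℕtoℚ-+ : ∀ a b → ℕtoℚ (a + b) ≡ ℕtoℚ a +ℚ ℕtoℚ b
ℕtoℚ-+ a b = begin
  + (a + b) ℚ./ 1                      ≡⟨ cong (ℚ._/ 1) (cong₂ ℤ._+_ (ℤ.*-identityʳ (+ a)) (ℤ.*-identityʳ (+ b))) ⟨
  (+ a ℤ.* + 1 ℤ.+ + b ℤ.* + 1) ℚ./ 1  ≡⟨ cong₂ _+ℚ_ (ℕtoℚ≡mkℚ a) (ℕtoℚ≡mkℚ b) ⟨
  ℕtoℚ a +ℚ ℕtoℚ b                     ∎
  where open ≡-Reasoning

ℕtoℚ-* : ∀ a b → ℕtoℚ (a * b) ≡ ℕtoℚ a *ℚ ℕtoℚ b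
ℕtoℚ-* a b = begin
  + (a * b) ℚ./ 1      ≡⟨ cong (ℚ._/ 1) (ℤ.pos-* a b) ⟩
  (+ a ℤ.* + b) ℚ./ 1  ≡⟨ cong₂ _*ℚ_ (ℕtoℚ≡mkℚ a) (ℕtoℚ≡mkℚ b) ⟨
  ℕtoℚ a *ℚ ℕtoℚ b     ∎
  where open ≡-Reasoning

ℕtoℚ-mono-≤ : ∀ {a b} → a ℕ.≤ b → ℕtoℚ a ≤ ℕtoℚ b
ℕtoℚ-mono-≤ {a} {b} a≤b rewrite ℕtoℚ≡mkℚ a | ℕtoℚ≡mkℚ b =
  *≤* (subst₂ ℤ._≤_ (sym (ℤ.*-identityʳ (+ a))) (sym (ℤ.*-identityʳ (+ b))) (+≤+ a≤b))

0≤ℕtoℚ : ∀ a → 0ℚ ≤ ℕtoℚ a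
0≤ℕtoℚ a = ℕtoℚ-mono-≤ {0} {a} ℕ.z≤n

ℕtoℚ-∸ : ∀ {a b} → b ℕ.≤ a → ℕtoℚ (a ∸ b) ≡ ℕtoℚ a - ℕtoℚ b
ℕtoℚ-∸ {a} {b} b≤a = begin
  ℕtoℚ (a ∸ b)                           ≡⟨ solve 2 (λ x y → x := (x :+ y) :- y) refl (ℕtoℚ (a ∸ b)) (ℕtoℚ b) ⟩
  (ℕtoℚ (a ∸ b) +ℚ ℕtoℚ b) - ℕtoℚ b     ≡⟨ cong (_- ℕtoℚ b) (ℕtoℚ-+ (a ∸ b) b) ⟨
  ℕtoℚ (a ∸ b + b) - ℕtoℚ b             ≡⟨ cong (λ c → ℕtoℚ c - ℕtoℚ b) (ℕ.m∸n+n≡m b≤a) ⟩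
  ℕtoℚ a - ℕtoℚ b                        ∎
  where open ≡-Reasoning

ℕtoℚ-∸-≥ : ∀ a b → ℕtoℚ a - ℕtoℚ b ≤ ℕtoℚ (a ∸ b)
ℕtoℚ-∸-≥ a b with b ℕ.≤? a
... | yes b≤a = ℚ.≤-reflexive (sym (ℕtoℚ-∸ b≤a))
... | no b≰a = begin
  ℕtoℚ a - ℕtoℚ b  ≤⟨ ℚ.+-monoˡ-≤ (- ℕtoℚ b) (ℕtoℚ-mono-≤ (ℕ.<⇒≤ (ℕ.≰⇒> b≰a))) ⟩
  ℕtoℚ b - ℕtoℚ b  ≡⟨ ℚ.+-inverseʳ (ℕtoℚ b) ⟩
  0ℚ               ≤⟨ 0≤ℕtoℚ (a ∸ b) ⟩
  ℕtoℚ (a ∸ b)     ∎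
  where open ℚ.≤-Reasoning

ℕtoℚ-m+n≤o⇒m≤o-n : ∀ a b c → a + b ℕ.≤ c → ℕtoℚ a ≤ ℕtoℚ c - ℕtoℚ b
ℕtoℚ-m+n≤o⇒m≤o-n a b c a+b≤c =
  ℚ.≤-trans (ℕtoℚ-mono-≤ (ℕ.m+n≤o⇒m≤o∸n a a+b≤c))
            (ℚ.≤-reflexive (ℕtoℚ-∸ (ℕ.m+n≤o⇒n≤o a a+b≤c)))

p≤q⇒0≤q-p : ∀ {p q} → p ≤ q → 0ℚ ≤ q - p
p≤q⇒0≤q-p {p} {q} p≤q = ℚ.≤-trans (ℚ.≤-reflexive (sym (ℚ.+-inverseʳ p))) (ℚ.+-monoˡ-≤ (- p) p≤q)

*-mono-≤-nonNeg : ∀ {a₁ a₂ b₁ b₂} → 0ℚ ≤ a₁ → 0ℚ ≤ b₁ → a₁ ≤ a₂ → b₁ ≤ b₂ →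
                  a₁ *ℚ b₁ ≤ a₂ *ℚ b₂
*-mono-≤-nonNeg {a₁} {a₂} {b₁} 0≤a₁ 0≤b₁ a₁≤a₂ b₁≤b₂ =
  ℚ.≤-trans (ℚ.*-monoʳ-≤-nonNeg b₁ {{ℚ.nonNegative 0≤b₁}} a₁≤a₂)
            (ℚ.*-monoˡ-≤-nonNeg a₂ {{ℚ.nonNegative (ℚ.≤-trans 0≤a₁ a₁≤a₂)}} b₁≤b₂)

0≤* : ∀ {a b} → 0ℚ ≤ a → 0ℚ ≤ b → 0ℚ ≤ a *ℚ b
0≤* {a} {b} 0≤a 0≤b = ℚ.nonNegative⁻¹ (a *ℚ b)
  {{ℚ.nonNeg*nonNeg⇒nonNeg a {{ℚ.nonNegative 0≤a}} b {{ℚ.nonNegative 0≤b}}}}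

p≤∣p∣ : ∀ p → p ≤ ∣ p ∣
p≤∣p∣ p with ℚ.≤-total 0ℚ p
... | inj₁ 0≤p = ℚ.≤-reflexive (sym (ℚ.0≤p⇒∣p∣≡p 0≤p))
... | inj₂ p≤0 = ℚ.≤-trans p≤0 (ℚ.0≤∣p∣ p)

gap≤Δ+Δ : ∀ o a b {Δ} → ∣ o - a ∣ ≤ Δ → ∣ o - b ∣ ≤ Δ → a - b ≤ Δ +ℚ Δ
gap≤Δ+Δ o a b {Δ} ∣o-a∣≤Δ ∣o-b∣≤Δ = begin
  a - b                      ≡⟨ solve 3 (λ o a b → a :- b := (o :- b) :- (o :- a)) refl o a b ⟩
  (o - b) - (o - a)          ≤⟨ p≤∣p∣ ((o - b) - (o - a)) ⟩
  ∣ (o - b) - (o - a) ∣      ≤⟨ ℚ.∣p-q∣≤∣p∣+∣q∣ (o - b) (o - a) ⟩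
  ∣ o - b ∣ +ℚ ∣ o - a ∣     ≤⟨ ℚ.+-mono-≤ ∣o-b∣≤Δ ∣o-a∣≤Δ ⟩
  Δ +ℚ Δ                     ∎
  where open ℚ.≤-Reasoning

ℕtoℚ-∸≤Δ+Δ : ∀ o a b {Δ} → ∣ o - ℕtoℚ a ∣ ≤ Δ → ∣ o - ℕtoℚ b ∣ ≤ Δ →
             ℕtoℚ (a ∸ b) ≤ Δ +ℚ Δ
ℕtoℚ-∸≤Δ+Δ o a b {Δ} ∣o-a∣≤Δ ∣o-b∣≤Δ with b ℕ.≤? a
... | yes b≤a = ℚ.≤-trans (ℚ.≤-reflexive (ℕtoℚ-∸ b≤a))
                          (gap≤Δ+Δ o (ℕtoℚ a) (ℕtoℚ b) ∣o-a∣≤Δ ∣o-b∣≤Δ)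
... | no b≰a  = ℚ.≤-trans (ℚ.≤-reflexive (cong ℕtoℚ (ℕ.m≤n⇒m∸n≡0 (ℕ.<⇒≤ (ℕ.≰⇒> b≰a)))))
                          (ℚ.+-mono-≤ 0≤Δ 0≤Δ)
  where
  0≤Δ : 0ℚ ≤ Δ
  0≤Δ = ℚ.≤-trans (ℚ.0≤∣p∣ (o - ℕtoℚ a)) ∣o-a∣≤Δ

-- Generalised binomial coefficients

falling-1+ : ∀ y i → falling (1ℚ +ℚ y) (suc i) ≡ (1ℚ +ℚ y) *ℚ falling y i
falling-1+ y zero = solve 1 (λ y → con 1ℚ :* ((con 1ℚ :+ y) :- con 0ℚ) := (con 1ℚ :+ y) :* con 1ℚ) refl y
falling-1+ y (suc i) rewrite falling-1+ y i | ℕtoℚ-+ 1 i =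
  solve 3 (λ y f c → (con 1ℚ :+ y) :* f :* ((con 1ℚ :+ y) :- (con 1ℚ :+ c)) := (con 1ℚ :+ y) :* (f :* (y :- c)))
        refl y (falling y i) (ℕtoℚ i)

1/[_!] : ℕ → ℚ
1/[ k !] = (+ 1 ℚ./ (k !)) {{k ℕ.!≢0}}

ℕtoℚ*1/[n]≡1 : ∀ n .{{_ : ℕ.NonZero n}} → ℕtoℚ n *ℚ (+ 1 ℚ./ n) ≡ 1ℚ
ℕtoℚ*1/[n]≡1 (suc d) rewrite ℕtoℚ≡mkℚ (suc d) | ℚ.normalize-coprime {1} {d} (1-coprimeTo (suc d)) =
  ℚ.*-inverseʳ (mkℚ (+ suc d) 0 (coprime-sym (1-coprimeTo (suc d))))

1/[suc!] : ∀ k → ℕtoℚ (suc k) *ℚ 1/[ suc k !] ≡ 1/[ k !]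
1/[suc!] k = begin
  c *ℚ v                        ≡⟨ ℚ.*-identityʳ (c *ℚ v) ⟨
  (c *ℚ v) *ℚ 1ℚ                ≡⟨ cong ((c *ℚ v) *ℚ_) (ℕtoℚ*1/[n]≡1 (k !) {{k ℕ.!≢0}}) ⟨
  (c *ℚ v) *ℚ (f *ℚ u)          ≡⟨ solve 4 (λ c v f u → (c :* v) :* (f :* u) := ((c :* f) :* v) :* u) refl c v f u ⟩
  ((c *ℚ f) *ℚ v) *ℚ u          ≡⟨ cong (λ z → (z *ℚ v) *ℚ u) (ℕtoℚ-* (suc k) (k !)) ⟨
  (ℕtoℚ (suc k !) *ℚ v) *ℚ u    ≡⟨ cong (_*ℚ u) (ℕtoℚ*1/[n]≡1 (suc k !) {{suc k ℕ.!≢0}}) ⟩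
  1ℚ *ℚ u                       ≡⟨ ℚ.*-identityˡ u ⟩
  u                             ∎
  where
  open ≡-Reasoning
  c f u v : ℚ
  c = ℕtoℚ (suc k)
  f = ℕtoℚ (k !)
  u = 1/[ k !]
  v = 1/[ suc k !]

binomQ-pascal : ∀ y k → binomQ (1ℚ +ℚ y) (suc k) ≡ binomQ y (suc k) +ℚ binomQ y k
binomQ-pascal y k = begin
  falling (1ℚ +ℚ y) (suc k) *ℚ v
    ≡⟨ cong (_*ℚ v) (falling-1+ y k) ⟩
  ((1ℚ +ℚ y) *ℚ f) *ℚ v
    ≡⟨ solve 4 (λ y f c v → ((con 1ℚ :+ y) :* f) :* v
                          := (f :* (y :- c)) :* v :+ f :* ((con 1ℚ :+ c) :* v)) refl y f (ℕtoℚ k) v ⟩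
  (f *ℚ (y - ℕtoℚ k)) *ℚ v +ℚ f *ℚ ((1ℚ +ℚ ℕtoℚ k) *ℚ v)
    ≡⟨ cong (λ c → binomQ y (suc k) +ℚ f *ℚ (c *ℚ v)) (ℕtoℚ-+ 1 k) ⟨
  binomQ y (suc k) +ℚ f *ℚ (ℕtoℚ (suc k) *ℚ v)
    ≡⟨ cong (λ u → binomQ y (suc k) +ℚ f *ℚ u) (1/[suc!] k) ⟩
  binomQ y (suc k) +ℚ binomQ y k
    ∎
  where
  open ≡-Reasoning
  f v : ℚ
  f = falling y k
  v = 1/[ suc k !]

falling-nonNeg-mono : ∀ i {y₁ y₂} → y₁ ≤ y₂ → ℕtoℚ i ≤ y₁ +ℚ 1ℚ →
                      0ℚ ≤ falling y₁ i × falling y₁ i ≤ falling y₂ i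
falling-nonNeg-mono zero    y₁≤y₂ _ = ℚ.nonNegative⁻¹ 1ℚ , ℚ.≤-refl
falling-nonNeg-mono (suc i) {y₁} {y₂} y₁≤y₂ i+1≤y₁+1 =
  0≤* 0≤f 0≤y₁-i , *-mono-≤-nonNeg 0≤f 0≤y₁-i f≤f (ℚ.+-monoˡ-≤ (- ℕtoℚ i) y₁≤y₂)
  where
  i≤y₁+1 : ℕtoℚ i ≤ y₁ +ℚ 1ℚ
  i≤y₁+1 = ℚ.≤-trans (ℕtoℚ-mono-≤ (ℕ.n≤1+n i)) i+1≤y₁+1
  0≤f : 0ℚ ≤ falling y₁ i
  0≤f = proj₁ (falling-nonNeg-mono i y₁≤y₂ i≤y₁+1)
  f≤f : falling y₁ i ≤ falling y₂ i
  f≤f = proj₂ (falling-nonNeg-mono i y₁≤y₂ i≤y₁+1)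
  0≤y₁-i : 0ℚ ≤ y₁ - ℕtoℚ i
  0≤y₁-i = ℚ.≤-trans (p≤q⇒0≤q-p i+1≤y₁+1) (ℚ.≤-reflexive (begin
    (y₁ +ℚ 1ℚ) - ℕtoℚ (suc i)
      ≡⟨ cong (λ c → (y₁ +ℚ 1ℚ) - c) (ℕtoℚ-+ 1 i) ⟩
    (y₁ +ℚ 1ℚ) - (1ℚ +ℚ ℕtoℚ i)
      ≡⟨ solve 2 (λ y c → (y :+ con 1ℚ) :- (con 1ℚ :+ c) := y :- c) refl y₁ (ℕtoℚ i) ⟩
    y₁ - ℕtoℚ i
      ∎))
    where open ≡-Reasoning

binomQ-mono-≤ : ∀ k {y₁ y₂} → y₁ ≤ y₂ → ℕtoℚ k ≤ y₁ +ℚ 1ℚ → binomQ y₁ k ≤ binomQ y₂ k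
binomQ-mono-≤ k y₁≤y₂ k≤y₁+1 =
  ℚ.*-monoʳ-≤-nonNeg 1/[ k !] {{ℚ.normalize-nonNeg 1 (k !) {{k ℕ.!≢0}}}}
    (proj₂ (falling-nonNeg-mono k y₁≤y₂ k≤y₁+1))

-- Iterated partial sums and sums over the simplex

sumTo : (ℕ → ℕ) → ℕ → ℕ
sumTo f zero    = f zero
sumTo f (suc t) = sumTo f t + f (suc t)

sumTo-cong : ∀ {f g} → f ≗ g → ∀ t → sumTo f t ≡ sumTo g t
sumTo-cong f≗g zero    = f≗g 0
sumTo-cong f≗g (suc t) = cong₂ _+_ (sumTo-cong f≗g t) (f≗g (suc t))

sumTo-+ : ∀ f g t → sumTo (λ j → f j + g j) t ≡ sumTo f t + sumTo g t
sumTo-+ f g zero    = refl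
sumTo-+ f g (suc t) rewrite sumTo-+ f g t = +-interchange (sumTo f t) (sumTo g t) (f (suc t)) (g (suc t))

sumTo-unfoldˡ : ∀ f t → sumTo f (suc t) ≡ f 0 + sumTo (f ∘ suc) t
sumTo-unfoldˡ f zero    = refl
sumTo-unfoldˡ f (suc t) rewrite sumTo-unfoldˡ f t = ℕ.+-assoc (f 0) (sumTo (f ∘ suc) t) _

sumTo-reverse : ∀ f t → sumTo (λ a → f (t ∸ a)) t ≡ sumTo f t
sumTo-reverse f zero    = refl
sumTo-reverse f (suc t) rewrite sumTo-unfoldˡ (λ a → f (suc t ∸ a)) t | sumTo-reverse f t =
  ℕ.+-comm (f (suc t)) (sumTo f t)

sumTo-shift : ∀ d f → f 0 ≡ 0 → ∀ t → sumTo (λ j → f (j ∸ d)) t ≡ sumTo f (t ∸ d)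
sumTo-shift d f f0≡0 zero rewrite ℕ.0∸n≡0 d = refl
sumTo-shift d f f0≡0 (suc t) with d ℕ.≤? t
... | yes d≤t rewrite sumTo-shift d f f0≡0 t | ℕ.+-∸-assoc 1 d≤t = refl
... | no d≰t  rewrite sumTo-shift d f f0≡0 t | ℕ.m≤n⇒m∸n≡0 (ℕ.≰⇒> d≰t)
                    | ℕ.m≤n⇒m∸n≡0 (ℕ.<⇒≤ (ℕ.≰⇒> d≰t)) | f0≡0 = refl

sum-applyUpTo : ∀ (f h : ℕ → ℕ) t → sumL (map f (applyUpTo h (suc t))) ≡ sumTo (f ∘ h) t
sum-applyUpTo f h zero    = ℕ.+-identityʳ (f (h 0))
sum-applyUpTo f h (suc t) rewrite sum-applyUpTo f (h ∘ suc) t = sym (sumTo-unfoldˡ (f ∘ h) t)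

iterSum : ℕ → (ℕ → ℕ) → ℕ → ℕ
iterSum zero    g = g
iterSum (suc m) g = sumTo (iterSum m g)

iterSum-at-0 : ∀ m g → iterSum m g 0 ≡ g 0
iterSum-at-0 zero    g = refl
iterSum-at-0 (suc m) g = iterSum-at-0 m g

iterSum-cong : ∀ m {f g} → f ≗ g → ∀ t → iterSum m f t ≡ iterSum m g t
iterSum-cong zero    f≗g = f≗g
iterSum-cong (suc m) f≗g = sumTo-cong (iterSum-cong m f≗g)

iterSum-+ : ∀ m f g t → iterSum m (λ s → f s + g s) t ≡ iterSum m f t + iterSum m g t
iterSum-+ zero    f g t = refl
iterSum-+ (suc m) f g t =
  trans (sumTo-cong (iterSum-+ m f g) t) (sumTo-+ (iterSum m f) (iterSum m g) t)

iterSum-shift : ∀ m d g → g 0 ≡ 0 → ∀ t → iterSum m (λ s → g (s ∸ d)) t ≡ iterSum m g (t ∸ d)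
iterSum-shift zero    d g g0≡0 t = refl
iterSum-shift (suc m) d g g0≡0 t =
  trans (sumTo-cong (iterSum-shift m d g g0≡0) t)
        (sumTo-shift d (iterSum m g) (trans (iterSum-at-0 m g) g0≡0) t)

iterSum-⊓ : ∀ m d t → iterSum m (d ⊓_) t + iterSum m id (t ∸ d) ≡ iterSum m id t
iterSum-⊓ m d t = begin
  iterSum m (d ⊓_) t + iterSum m id (t ∸ d)     ≡⟨ cong (λ s → iterSum m (d ⊓_) t + s) (iterSum-shift m d id refl t) ⟨
  iterSum m (d ⊓_) t + iterSum m (_∸ d) t       ≡⟨ iterSum-+ m (d ⊓_) (_∸ d) t ⟨
  iterSum m (λ s → d ⊓ s + (s ∸ d)) t           ≡⟨ iterSum-cong m (ℕ.m⊓n+n∸m≡n d) t ⟩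
  iterSum m id t                                ∎
  where open ≡-Reasoning

simplexSum : (ℕ → ℕ) → ℕ → ℕ → ℕ
simplexSum g m t = sumL (map (λ x → g (t ∸ Vec.sum x)) (tuples m t))

sum-concatMap : ∀ {A B : Set} (f : B → ℕ) (h : A → List B) xs →
                sumL (map f (concatMap h xs)) ≡ sumL (map (λ a → sumL (map f (h a))) xs)
sum-concatMap f h []       = refl
sum-concatMap f h (a ∷ xs) rewrite List.map-++ f (h a) (concatMap h xs)
                                 | sum-++ (map f (h a)) (map f (concatMap h xs))
                                 | sum-concatMap f h xs = refl

simplexSum-suc : ∀ g m t → simplexSum g (suc m) t ≡ sumTo (λ a → simplexSum g m (t ∸ a)) t
simplexSum-suc g m t = begin
  sumL (map summand (concatMap prepend (upTo (suc t))))
    ≡⟨ sum-concatMap summand prepend (upTo (suc t)) ⟩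
  sumL (map (λ a → sumL (map summand (prepend a))) (upTo (suc t)))
    ≡⟨ cong sumL (List.map-cong first-coordinate (upTo (suc t))) ⟩
  sumL (map (λ a → simplexSum g m (t ∸ a)) (upTo (suc t)))
    ≡⟨ sum-applyUpTo (λ a → simplexSum g m (t ∸ a)) id t ⟩
  sumTo (λ a → simplexSum g m (t ∸ a)) t
    ∎
  where
  open ≡-Reasoning
  summand : Vec ℕ (suc m) → ℕ
  summand x = g (t ∸ Vec.sum x)
  prepend : ℕ → List (Vec ℕ (suc m))
  prepend a = map (a Vec.∷_) (tuples m (t ∸ a))
  first-coordinate : ∀ a → sumL (map summand (prepend a)) ≡ simplexSum g m (t ∸ a)
  first-coordinate a = trans (cong sumL (sym (List.map-∘ (tuples m (t ∸ a)))))
    (cong sumL (List.map-cong (λ y → cong g (sym (ℕ.∸-+-assoc t a (Vec.sum y)))) (tuples m (t ∸ a))))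

simplexSum≡iterSum : ∀ g m t → simplexSum g m t ≡ iterSum m g t
simplexSum≡iterSum g zero    t = ℕ.+-identityʳ (g t)
simplexSum≡iterSum g (suc m) t = begin
  simplexSum g (suc m) t                    ≡⟨ simplexSum-suc g m t ⟩
  sumTo (λ a → simplexSum g m (t ∸ a)) t    ≡⟨ sumTo-cong (λ a → simplexSum≡iterSum g m (t ∸ a)) t ⟩
  sumTo (λ a → iterSum m g (t ∸ a)) t       ≡⟨ sumTo-reverse (iterSum m g) t ⟩
  iterSum (suc m) g t                       ∎
  where open ≡-Reasoning

iterSum-id≡binomQ : ∀ m t → ℕtoℚ (iterSum m id t) ≡ binomQ (ℕtoℚ (t + m)) (suc m)
iterSum-id≡binomQ zero t =
  trans (solve 1 (λ y → y := (con 1ℚ :* (y :- con 0ℚ)) :* con 1ℚ) refl (ℕtoℚ t))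
        (cong (λ s → binomQ (ℕtoℚ s) 1) (sym (ℕ.+-identityʳ t)))
iterSum-id≡binomQ (suc m) zero rewrite iterSum-at-0 m id = begin
  0ℚ                       ≡⟨ ℚ.*-zeroˡ v ⟨
  0ℚ *ℚ v                  ≡⟨ cong (_*ℚ v) (ℚ.*-zeroʳ f) ⟨
  (f *ℚ 0ℚ) *ℚ v           ≡⟨ cong (λ z → (f *ℚ z) *ℚ v) (ℚ.+-inverseʳ y) ⟨
  (f *ℚ (y - y)) *ℚ v      ∎
  where
  open ≡-Reasoning
  y f v : ℚ
  y = ℕtoℚ (suc m)
  f = falling y (suc m)
  v = 1/[ suc (suc m) !]
iterSum-id≡binomQ (suc m) (suc t) = begin
  ℕtoℚ (iterSum (suc m) id t + iterSum m id (suc t))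
    ≡⟨ ℕtoℚ-+ (iterSum (suc m) id t) (iterSum m id (suc t)) ⟩
  ℕtoℚ (iterSum (suc m) id t) +ℚ ℕtoℚ (iterSum m id (suc t))
    ≡⟨ cong₂ _+ℚ_ (iterSum-id≡binomQ (suc m) t) (iterSum-id≡binomQ m (suc t)) ⟩
  binomQ (ℕtoℚ (t + suc m)) (suc (suc m)) +ℚ binomQ y (suc m)
    ≡⟨ cong (λ s → binomQ (ℕtoℚ s) (suc (suc m)) +ℚ binomQ y (suc m)) (ℕ.+-suc t m) ⟩
  binomQ y (suc (suc m)) +ℚ binomQ y (suc m)
    ≡⟨ binomQ-pascal y (suc m) ⟨
  binomQ (1ℚ +ℚ y) (suc (suc m))
    ≡⟨ cong (λ z → binomQ z (suc (suc m))) (ℕtoℚ-+ 1 (suc t + m)) ⟨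
  binomQ (ℕtoℚ (suc (suc t + m))) (suc (suc m))
    ≡⟨ cong (λ s → binomQ (ℕtoℚ (suc s)) (suc (suc m))) (ℕ.+-suc t m) ⟨
  binomQ (ℕtoℚ (suc t + suc m)) (suc (suc m))
    ∎
  where
  open ≡-Reasoning
  y : ℚ
  y = ℕtoℚ (suc t + m)

greatest-below : ∀ {P : ℕ → Set} → Decidable P → P 0 → ∀ N →
                 ∃[ e ] P e × (∀ {a} → a ℕ.≤ N → P a → a ℕ.≤ e)
greatest-below P? P0 zero = 0 , P0 , λ a≤0 _ → a≤0
greatest-below {P} P? P0 (suc N) with P? (suc N) | greatest-below P? P0 N
... | yes PN+1 | _ = suc N , PN+1 , λ a≤N+1 _ → a≤N+1
... | no ¬PN+1 | e , Pe , e-greatest = e , Pe , below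
  where
  below : ∀ {a} → a ℕ.≤ suc N → P a → a ℕ.≤ e
  below {a} a≤N+1 Pa with ℕ.m≤n⇒m<n∨m≡n a≤N+1
  ... | inj₁ a<N+1 = e-greatest (ℕ.≤-pred a<N+1) Pa
  ... | inj₂ refl = contradiction Pa ¬PN+1

max≤ : ∀ {A : Set} (f : A → ℕ) xs {B} → (∀ {p} → p ∈ xs → f p ℕ.≤ B) → foldr _⊔_ 0 (map f xs) ℕ.≤ B
max≤ f xs {B} f≤B = List.foldr-preservesᵇ {P = ℕ._≤ B} ℕ.⊔-lub ℕ.z≤n (All.map⁺ (All.tabulate f≤B))

max∸min≤ : ∀ {A : Set} (f : A → ℕ) xs {N e} → (∀ {p} → p ∈ xs → f p ℕ.≤ N) →
           (∀ {p q} → p ∈ xs → q ∈ xs → f p ∸ f q ℕ.≤ e) →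
           foldr _⊔_ 0 (map f xs) ∸ foldr _⊓_ N (map f xs) ℕ.≤ e
max∸min≤ f xs {N} f≤N gap≤e
  with foldr _⊔_ 0 (map f xs) | foldr-selective ℕ.⊔-sel 0 (map f xs) | max≤ f xs f≤N
     | foldr _⊓_ N (map f xs) | foldr-selective ℕ.⊓-sel N (map f xs)
... | _ | inj₁ refl | _ | b | _ = ℕ.≤-trans (ℕ.≤-reflexive (ℕ.0∸n≡0 b)) ℕ.z≤n
... | a | inj₂ _ | a≤N | _ | inj₁ refl = ℕ.≤-trans (ℕ.≤-reflexive (ℕ.m≤n⇒m∸n≡0 a≤N)) ℕ.z≤n
... | a | inj₂ a∈ | _ | b | inj₂ b∈ with ∈-map⁻ f a∈ | ∈-map⁻ f b∈
...   | p , p∈ , refl | q , q∈ , refl = gap≤e p∈ q∈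

sum-map-mono-≤ : ∀ {A : Set} {f g : A → ℕ} → (∀ x → f x ℕ.≤ g x) → ∀ xs →
                 sumL (map f xs) ℕ.≤ sumL (map g xs)
sum-map-mono-≤ f≤g []       = ℕ.z≤n
sum-map-mono-≤ f≤g (x ∷ xs) = ℕ.+-mono-≤ (f≤g x) (sum-map-mono-≤ f≤g xs)

sum-tabulate-≤ : ∀ {m} e (h : Fin m → ℕ) (x : Vec ℕ m) → (∀ j → h j ℕ.≤ lookup x j + e) →
                 sumL (List.tabulate h) ℕ.≤ Vec.sum x + m * e
sum-tabulate-≤ e h Vec.[]       h≤x+e = ℕ.z≤n
sum-tabulate-≤ e h (x₀ Vec.∷ x) h≤x+e =
  ℕ.≤-trans (ℕ.+-mono-≤ (h≤x+e Fin.zero) (sum-tabulate-≤ e (h ∘ Fin.suc) x (h≤x+e ∘ Fin.suc)))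
            (ℕ.≤-reflexive (+-interchange x₀ e (Vec.sum x) _))

-- Programs computing approximate counts

-- In effect e = ⌊2Δ⌋; asking only about a ≤ n lets e be found by a bounded search.
module ApproxCounter {m n : ℕ} {Δ : ℚ} (P : ROBP (suc m) n) (computes : Computes P Δ)
  (e : ℕ) (e-bounds-gaps : ∀ {a} → a ℕ.≤ n → ℕtoℚ a ≤ Δ +ℚ Δ → a ℕ.≤ e) where
  open ROBP P
  open Potential P

  same-end⇒count-gap≤e : ∀ {p q} → run P n p ≡ run P n q → ∀ (j : Fin (suc m)) →
                         countSym (toℕ j) p ∸ countSym (toℕ j) q ℕ.≤ e
  same-end⇒count-gap≤e {p} {q} p≡q j =
    e-bounds-gaps (ℕ.≤-trans (ℕ.m∸n≤m a b) (Vec.count≤n _ p)) (ℕtoℚ-∸≤Δ+Δ o a b (computes p j) b-close)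
    where
    a b : ℕ
    a = countSym (toℕ j) p
    b = countSym (toℕ j) q
    o : ℚ
    o = lookup (out (run P n p)) j
    b-close : ∣ o - ℕtoℚ b ∣ ≤ Δ
    b-close = subst (λ v → ∣ lookup (out v) j - ℕtoℚ b ∣ ≤ Δ) (sym p≡q) (computes q j)

  reaching⇒run : ∀ {t v p} → p ∈ reaching t v → run P t p ≡ v
  reaching⇒run {t} {v} p∈ = proj₂ (∈-filter⁻ (λ p → run P t p ≟ᶠ v) {xs = allVecs (suc m) t} p∈)

  hi∸lo≤e : ∀ v j → hi n v j ∸ lo n v j ℕ.≤ e
  hi∸lo≤e v j = max∸min≤ count (reaching n v) (λ {p} _ → Vec.count≤n _ p) gap≤e
    where
    count : Vec (Fin (suc m)) n → ℕ
    count = countSym (toℕ j)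
    gap≤e : ∀ {p q} → p ∈ reaching n v → q ∈ reaching n v → count p ∸ count q ℕ.≤ e
    gap≤e p∈ q∈ rewrite sym (toℕ-inject₁ j) =
      same-end⇒count-gap≤e (trans (reaching⇒run p∈) (sym (reaching⇒run q∈))) (inject₁ j)

  inBox⇒lo≤ : ∀ v x → inBox n v x ≡ true → ∀ j → lo n v j ℕ.≤ lookup x j
  inBox⇒lo≤ v x x∈R j = ℕ.≤ᵇ⇒≤ (lo n v j) (lookup x j) (proj₁ (Equivalence.to Bool.T-∧ inside-j))
    where
    inside : Fin m → Bool
    inside j = (lo n v j ≤ᵇ lookup x j) ∧ (lookup x j ≤ᵇ hi n v j)
    inside-j : T (inside j)
    inside-j = All.lookup (All.all⁺ inside (allFin m) (Equivalence.from Bool.T-≡ x∈R)) (∈-allFin j)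

  inBox⇒sumHi≤ : ∀ v x → inBox n v x ≡ true → sumHi n v ℕ.≤ Vec.sum x + m * e
  inBox⇒sumHi≤ v x x∈R rewrite List.map-tabulate id (hi n v) = sum-tabulate-≤ e (hi n v) x hi≤x+e
    where
    hi≤x+e : ∀ j → hi n v j ℕ.≤ lookup x j + e
    hi≤x+e j = ℕ.≤-trans (ℕ.m≤n+m∸n (hi n v j) (lo n v j)) (ℕ.+-mono-≤ (inBox⇒lo≤ v x x∈R j) (hi∸lo≤e v j))

  phi≤ : ∀ x → phi n x ℕ.≤ (m * e) ⊓ (n ∸ Vec.sum x)
  phi≤ x = max≤ value boxes bound
    where
    boxes : List (Fin (width n))
    boxes = filter (λ v → inBox n v x Bool.≟ true) (allFin (width n))
    value : Fin (width n) → ℕ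
    value v = (sumHi n v ⊓ n) ∸ Vec.sum x
    bound : ∀ {v} → v ∈ boxes → value v ℕ.≤ (m * e) ⊓ (n ∸ Vec.sum x)
    bound {v} v∈ = ℕ.⊓-glb
      (ℕ.m≤n+o⇒m∸n≤o (sumHi n v ⊓ n) (Vec.sum x) (ℕ.≤-trans (ℕ.m⊓n≤m _ n) (inBox⇒sumHi≤ v x x∈R)))
      (ℕ.∸-monoˡ-≤ (Vec.sum x) (ℕ.m⊓n≤n _ n))
      where
      x∈R : inBox n v x ≡ true
      x∈R = proj₂ (∈-filter⁻ (λ v → inBox n v x Bool.≟ true) {xs = allFin (width n)} v∈)

  Phi+iterSum≤iterSum : Phi n + iterSum m id (n ∸ m * e) ℕ.≤ iterSum m id n
  Phi+iterSum≤iterSum = begin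
    Phi n + iterSum m id (n ∸ d)                  ≤⟨ ℕ.+-monoˡ-≤ _ (sum-map-mono-≤ phi≤ (tuples m n)) ⟩
    simplexSum (d ⊓_) m n + iterSum m id (n ∸ d)  ≡⟨ cong (_+ iterSum m id (n ∸ d)) (simplexSum≡iterSum (d ⊓_) m n) ⟩
    iterSum m (d ⊓_) n + iterSum m id (n ∸ d)     ≡⟨ iterSum-⊓ m d n ⟩
    iterSum m id n                                ∎
    where
    open ℕ.≤-Reasoning
    d : ℕ
    d = m * e

ℕtoℚ[m*e]≤ : ∀ m e {Δ} → ℕtoℚ e ≤ Δ +ℚ Δ → ℕtoℚ (m * e) ≤ ℕtoℚ (2 * m) *ℚ Δ
ℕtoℚ[m*e]≤ m e {Δ} e≤Δ+Δ = begin
  ℕtoℚ (m * e)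
    ≡⟨ ℕtoℚ-* m e ⟩
  ℕtoℚ m *ℚ ℕtoℚ e
    ≤⟨ ℚ.*-monoˡ-≤-nonNeg (ℕtoℚ m) {{ℚ.nonNegative (0≤ℕtoℚ m)}} e≤Δ+Δ ⟩
  ℕtoℚ m *ℚ (Δ +ℚ Δ)
    ≡⟨ solve 2 (λ c δ → c :* (δ :+ δ) := ((con 1ℚ :+ con 1ℚ) :* c) :* δ) refl (ℕtoℚ m) Δ ⟩
  (ℕtoℚ 2 *ℚ ℕtoℚ m) *ℚ Δ
    ≡⟨ cong (_*ℚ Δ) (ℕtoℚ-* 2 m) ⟨
  ℕtoℚ (2 * m) *ℚ Δ
    ∎
  where open ℚ.≤-Reasoning

n-D+m≤ℕtoℚ[n∸d+m] : ∀ n m d {D} → ℕtoℚ d ≤ D → (ℕtoℚ n - D) +ℚ ℕtoℚ m ≤ ℕtoℚ (n ∸ d + m)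
n-D+m≤ℕtoℚ[n∸d+m] n m d {D} d≤D = begin
  (ℕtoℚ n - D) +ℚ ℕtoℚ m       ≤⟨ ℚ.+-monoˡ-≤ (ℕtoℚ m) (ℚ.+-monoʳ-≤ (ℕtoℚ n) (ℚ.neg-antimono-≤ d≤D)) ⟩
  (ℕtoℚ n - ℕtoℚ d) +ℚ ℕtoℚ m  ≤⟨ ℚ.+-monoˡ-≤ (ℕtoℚ m) (ℕtoℚ-∸-≥ n d) ⟩
  ℕtoℚ (n ∸ d) +ℚ ℕtoℚ m       ≡⟨ ℕtoℚ-+ (n ∸ d) m ⟨
  ℕtoℚ (n ∸ d + m)             ∎
  where open ℚ.≤-Reasoning

1+m≤n-D+m+1 : ∀ n m {D} → D ≤ ℕtoℚ n → ℕtoℚ (suc m) ≤ ((ℕtoℚ n - D) +ℚ ℕtoℚ m) +ℚ 1ℚ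
1+m≤n-D+m+1 n m {D} D≤n = begin
  ℕtoℚ (suc m)                 ≡⟨ ℕtoℚ-+ 1 m ⟩
  1ℚ +ℚ ℕtoℚ m                 ≡⟨ solve 1 (λ c → con 1ℚ :+ c := (con 0ℚ :+ c) :+ con 1ℚ) refl (ℕtoℚ m) ⟩
  (0ℚ +ℚ ℕtoℚ m) +ℚ 1ℚ         ≤⟨ ℚ.+-monoˡ-≤ 1ℚ (ℚ.+-monoˡ-≤ (ℕtoℚ m) (p≤q⇒0≤q-p D≤n)) ⟩
  ((ℕtoℚ n - D) +ℚ ℕtoℚ m) +ℚ 1ℚ  ∎
  where open ℚ.≤-Reasoning

potential-bound : ∀ m n Δ → 0ℚ ≤ Δ → ℕtoℚ (2 * m) *ℚ Δ ≤ ℕtoℚ n →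
                  (P : ROBP (suc m) n) → Computes P Δ →
                  ℕtoℚ (Potential.Phi P n)
                    ≤ binomQ (ℕtoℚ (n + m)) (suc m) - binomQ ((ℕtoℚ n - ℕtoℚ (2 * m) *ℚ Δ) +ℚ ℕtoℚ m) (suc m)
potential-bound m n Δ 0≤Δ D≤n P computes =
  let e , e≤Δ+Δ , e-bounds-gaps = greatest-below (λ a → ℕtoℚ a ℚ.≤? Δ +ℚ Δ) (ℚ.+-mono-≤ 0≤Δ 0≤Δ) n
      d : ℕ
      d = m * e
      y≤ : (ℕtoℚ n - ℕtoℚ (2 * m) *ℚ Δ) +ℚ ℕtoℚ m ≤ ℕtoℚ (n ∸ d + m)
      y≤ = n-D+m≤ℕtoℚ[n∸d+m] n m d (ℕtoℚ[m*e]≤ m e e≤Δ+Δ)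
  in begin
  ℕtoℚ (Potential.Phi P n)
    ≤⟨ ℕtoℚ-m+n≤o⇒m≤o-n _ (iterSum m id (n ∸ d)) (iterSum m id n)
         (ApproxCounter.Phi+iterSum≤iterSum P computes e e-bounds-gaps) ⟩
  ℕtoℚ (iterSum m id n) - ℕtoℚ (iterSum m id (n ∸ d))
    ≡⟨ cong₂ _-_ (iterSum-id≡binomQ m n) (iterSum-id≡binomQ m (n ∸ d)) ⟩
  binomQ (ℕtoℚ (n + m)) (suc m) - binomQ (ℕtoℚ (n ∸ d + m)) (suc m)
    ≤⟨ ℚ.+-monoʳ-≤ (binomQ (ℕtoℚ (n + m)) (suc m))
         (ℚ.neg-antimono-≤ (binomQ-mono-≤ (suc m) y≤ (1+m≤n-D+m+1 n m D≤n))) ⟩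
  binomQ (ℕtoℚ (n + m)) (suc m) - binomQ ((ℕtoℚ n - ℕtoℚ (2 * m) *ℚ Δ) +ℚ ℕtoℚ m) (suc m)
    ∎
  where open ℚ.≤-Reasoning

lemma4p6 : (k n : ℕ) (Δ : ℚ) → 2 Data.Nat.≤ k → 1 Data.Nat.≤ n →
           0ℚ ≤ Δ → ℕtoℚ (2 * (k ∸ 1)) *ℚ Δ ≤ ℕtoℚ n →
           (P : ROBP k n) → AllReachable P → Computes P Δ →
           ℕtoℚ (Potential.Phi P n)
             ≤ binomQ (ℕtoℚ (n + k ∸ 1)) k
               - binomQ ((ℕtoℚ n - ℕtoℚ (2 * (k ∸ 1)) *ℚ Δ) +ℚ ℕtoℚ (k ∸ 1)) k
lemma4p6 zero    n Δ ()
lemma4p6 (suc m) n Δ _ _ 0≤Δ D≤n P _ computes =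
  subst (λ c → ℕtoℚ (Potential.Phi P n) ≤ binomQ (ℕtoℚ (c ∸ 1)) (suc m) - binomQ y (suc m))
        (sym (ℕ.+-suc n m))
        (potential-bound m n Δ 0≤Δ D≤n P computes)
  where
  y : ℚ
  y = (ℕtoℚ n - ℕtoℚ (2 * m) *ℚ Δ) +ℚ ℕtoℚ m
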